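{- Let $n$ be a positive integer divisible by $8$ and $1\le k_1\le n/2$. Let $\mathcal{C}_1$ be a doubly even binary code of length $n$ and dimension $k_1$ with generator matrix $\begin{bmatrix}1&\mathbf{1}&\mathbf{1}\\0&I_{k_1-1}&A\end{bmatrix}$, where $A\in M_{(k_1-1)\times(n-k_1)}(\mathbf{Z})$ has all entries in $\{0,1\}$ (so that $I+AA^t\equiv0\pmod 2$ and $\mathrm{diag}(I+AA^t)\equiv0\pmod4$). Define $\alpha:M_{(k_1-1)\times(n-k_1)}(\mathbf{Z}_2)\to\mathbf{Z}_2^{k_1-1}$ by $N\bmod 2\mapsto\mathbf{1}N^t\bmod 2$, and $\Phi_A:M_{(k_1-1)\times(n-k_1)}(\mathbf{Z}_2)\to\mathrm{Sym}_{k_1-1}(\mathbf{Z}_2)$ by $N\bmod2\mapsto AN^t+NA^t+\mathrm{Diag}(AN^t)\bmod 2$. For $N\in M_{(k_1-1)\times(n-k_1)}(\mathbf{Z})$ let $\mathcal{C}$ be the quaternary code with generator matrix $\begin{bmatrix}1&\mathbf{1}&\mathbf{1}\\0&I_{k_1-1}&A+2N\end{bmatrix}$. Then $\mathcal{C}$ is even if and only if $$N\bmod 2\in\ker\alpha\cap\Phi_A^{ -1}\left(\tfrac12(I+AA^t)+\tfrac14(I+\mathrm{Diag}(AA^t))\bmod 2\right).$$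
   Context: $\mathbf{1}$ denotes an all-ones row vector of the appropriate length. An integer matrix $G\in M_{k\times n}(\mathbf{Z})$ is a generator matrix of the code $\mathcal{C}$ over $\mathbf{Z}_m$ if $\mathcal{C}=\{aG\bmod m:a\in\mathbf{Z}^k\}$. A binary code is doubly even if all Hamming weights are divisible by $4$. The Euclidean weight on $\mathbf{Z}_4$ is $\mathrm{wt}_e(0)=0$, $\mathrm{wt}_e(\pm1)=1$, $\mathrm{wt}_e(2)=4$, extended additively to vectors; a quaternary code is even if all its codewords have Euclidean weight divisible by $8$. $\mathrm{Sym}_m(\mathbf{Z}_2)$ is the set of symmetric $m\times m$ matrices over $\mathbf{Z}_2$; for a square matrix $S$, $\mathrm{Diag}(S)$ is the diagonal matrix with the diagonal entries of $S$ and $\mathrm{diag}(S)$ the vector of its diagonal entries. -}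

module Defs where

open import Data.Nat as ℕ using (ℕ; zero; suc)
open import Data.Integer as ℤ using (ℤ; +_)
open import Data.Integer.DivMod using (_/_; _%_)
open import Data.Fin using (Fin; zero; suc; splitAt; _≟_)
open import Data.Sum using (inj₁; inj₂)
open import Data.Bool using (if_then_else_)
open import Relation.Nullary using (does)
open import Data.Nat.Divisibility using (_∣_)
open import Relation.Binary.PropositionalEquality using (_≡_)

Mat : ℕ → ℕ → Set
Mat r c = Fin r → Fin c → ℤ

Vect : ℕ → Set
Vect c = Fin c → ℤ

Σℤ : ∀ {n} → (Fin n → ℤ) → ℤ
Σℤ {zero}  f = + 0
Σℤ {suc n} f = f zero ℤ.+ Σℤ (λ i → f (suc i))

Σℕ : ∀ {n} → (Fin n → ℕ) → ℕ
Σℕ {zero}  f = 0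
Σℕ {suc n} f = f zero ℕ.+ Σℕ (λ i → f (suc i))

_ᵗ : ∀ {r c} → Mat r c → Mat c r
(M ᵗ) i j = M j i

_·_ : ∀ {r s c} → Mat r s → Mat s c → Mat r c
(M · P) i j = Σℤ (λ l → M i l ℤ.* P l j)

_⊕_ : ∀ {r c} → Mat r c → Mat r c → Mat r c
(M ⊕ P) i j = M i j ℤ.+ P i j

_⊙_ : ∀ {r c} → ℤ → Mat r c → Mat r c
(a ⊙ M) i j = a ℤ.* M i j

I : ∀ {r} → Mat r r
I i j = if does (i ≟ j) then + 1 else + 0

Diag : ∀ {r} → Mat r r → Mat r r
Diag S i j = if does (i ≟ j) then S i i else + 0

𝟏· : ∀ {r c} → Mat r c → Vect c
𝟏· M j = Σℤ (λ i → M i j)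

-- entrywise halving / quartering (exact division in the situation of the lemma)
half : ∀ {r c} → Mat r c → Mat r c
half M i j = M i j / + 2

quarter : ∀ {r c} → Mat r c → Mat r c
quarter M i j = M i j / + 4

-- reduction mod 2 (values 0 or 1 as natural numbers, representing Z_2)
mod2 : ℤ → ℕ
mod2 x = x % + 2

-- the generator matrix  [ 1 𝟏 𝟏 ; 0 I_k B ]  of size (k+1) × (1 + k + m)
genMat : ∀ {k m} → Mat k m → Mat (suc k) (suc k ℕ.+ m)
genMat {k} B zero    j = + 1
genMat {k} B (suc i) j with splitAt (suc k) j
... | inj₁ zero     = + 0
... | inj₁ (suc i′) = I i i′
... | inj₂ l        = B i l

-- the codeword a G (over Z; reduce mod 2 or mod 4 as appropriate)
codeword : ∀ {r c} → Vect r → Mat r c → Vect c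
codeword a G j = Σℤ (λ i → a i ℤ.* G i j)

wtH₂ : ∀ {c} → Vect c → ℕ
wtH₂ v = Σℕ (λ j → if does (mod2 (v j) ℕ.≟ 0) then 0 else 1)

wtE₄ : ℤ → ℕ
wtE₄ x with x % + 4
... | 0 = 0
... | 1 = 1
... | 2 = 4
... | _ = 1

wtE : ∀ {c} → Vect c → ℕ
wtE v = Σℕ (λ j → wtE₄ (v j))

DoublyEvenBinary : ∀ {r c} → Mat r c → Set
DoublyEvenBinary {r} G = (a : Vect r) → 4 ∣ wtH₂ (codeword a G)

EvenQuaternary : ∀ {r c} → Mat r c → Set
EvenQuaternary {r} G = (a : Vect r) → 8 ∣ wtE (codeword a G)

InKerα : ∀ {k m} → Mat k m → Set
InKerα N = ∀ i → mod2 (𝟏· (N ᵗ) i) ≡ 0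

Φ : ∀ {k m} → Mat k m → Mat k m → Mat k k
Φ A N = ((A · (N ᵗ)) ⊕ (N · (A ᵗ))) ⊕ Diag (A · (N ᵗ))

Target : ∀ {k m} → Mat k m → Mat k k
Target A = half (I ⊕ (A · (A ᵗ))) ⊕ quarter (I ⊕ Diag (A · (A ᵗ)))

-- Over ℤ, wt_e(x) ≡ x² (mod 8) and wt_H(x mod 2) ≡ x² (mod 4), so evenness of a code is a
-- congruence for the quadratic form Q(x) = x·x on the integer span of its generator rows.
-- By polarisation, Q(x + y) = Q x + Q y + 2 x·y, the form Q is ≡ 0 (mod 2d) on that span iff
-- gᵢ·gᵢ ≡ 0 (mod 2d) and gᵢ·gⱼ ≡ 0 (mod d) for all rows. For [1 𝟏 𝟏; 0 I A+2N] the Gram entries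
-- are n, 1 + 𝟏(A+2N)ᵢᵗ and δᵢⱼ + (A+2N)ᵢ·(A+2N)ⱼ. The doubly even code of A gives
-- 1 + AᵢAᵢᵗ ≡ 0 (mod 4) and AᵢAⱼᵗ ≡ 0 (mod 2) for i ≠ j, and 𝟏Aᵢᵗ = AᵢAᵢᵗ for a 0/1 matrix;
-- with these the first-row conditions say 𝟏Nᵗ ≡ 0 (mod 2), and the remaining ones say, entry by
-- entry, Φ_A(N) ≡ ½(I + AAᵗ) + ¼(I + Diag(AAᵗ)) (mod 2).
module Submission where

module Lemmas where

  open import Defs
  open import Data.Nat as ℕ using (ℕ; zero; suc; s≤s)
  import Data.Nat.Properties as ℕ
  open import Data.Nat.Divisibility using () renaming (_∣_ to _∣ℕ_)
  open import Data.Integer as ℤ using (ℤ; +_; _+_; _*_; _-_; -_)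
  import Data.Integer.Properties as ℤ
  open import Data.Integer.DivMod using (_/_; _%_; a≡a%n+[a/n]*n; n%d<d)
  open import Data.Integer.Divisibility.Signed
  open import Data.Integer.Tactic.RingSolver using (solve-∀)
  open import Data.Fin using (Fin; zero; suc; _≟_; _↑ˡ_; _↑ʳ_)
  open import Data.Fin.Properties using (splitAt-↑ˡ; splitAt-↑ʳ)
  open import Data.Product using (_×_; _,_; proj₁; proj₂)
  open import Data.Sum using (_⊎_; inj₁; inj₂)
  open import Function.Base using (_∘_)
  open import Function.Bundles using (_⇔_; mk⇔; Equivalence)
  open import Function.Properties.Equivalence using (⇔-setoid) renaming (trans to ⇔-trans; sym to ⇔-sym)
  open import Level using (0ℓ)
  import Relation.Binary.Reasoning.Setoid
  open import Relation.Binary.PropositionalEquality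
  open import Relation.Nullary using (does; yes; no)
  open import Relation.Nullary.Decidable using (dec-true; dec-false)
  open import Data.Bool using (if_then_else_)

  module ⇔-Reasoning = Relation.Binary.Reasoning.Setoid (⇔-setoid 0ℓ)

  -- Integer congruences

  ∣ℕ⇔∣ : ∀ {d n} → d ∣ℕ n ⇔ + d ∣ + n
  ∣ℕ⇔∣ = mk⇔ ∣ᵤ⇒∣ ∣⇒∣ᵤ

  *-cancelˡ-∣⇔ : ∀ c {d x} .{{_ : ℤ.NonZero c}} → c * d ∣ c * x ⇔ d ∣ x
  *-cancelˡ-∣⇔ c = mk⇔ (*-cancelˡ-∣ c) (*-monoʳ-∣ c)

  ∣x-y⇒∣x⇔∣y : ∀ {d x y} → d ∣ x - y → d ∣ x ⇔ d ∣ y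
  ∣x-y⇒∣x⇔∣y {d} {x} {y} d∣x-y = mk⇔
    (λ d∣x → subst (d ∣_) (x-[x-y]≡y x y) (∣m∣n⇒∣m-n d∣x d∣x-y))
    (λ d∣y → subst (d ∣_) (x-y+y≡x x y) (∣m∣n⇒∣m+n d∣x-y d∣y))
    where
    x-[x-y]≡y : ∀ x y → x - (x - y) ≡ y
    x-[x-y]≡y = solve-∀
    x-y+y≡x : ∀ x y → x - y + y ≡ x
    x-y+y≡x = solve-∀

  -- |r - r′| < d forces the multiple of d to vanish.
  remainder-unique : ∀ {d r r′} → r ℕ.< d → r′ ℕ.< d → + d ∣ + r - + r′ → r ≡ r′
  remainder-unique {d} {r} {r′} r<d r′<d (divides s eq) =
    ℤ.+-injective (ℤ.i-j≡0⇒i≡j (+ r) (+ r′) (trans eq (cong (_* + d) s≡0)))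
    where
    ∣s∣*d≡∣r-r′∣ : ℤ.∣ s ∣ ℕ.* d ≡ ℤ.∣ + r - + r′ ∣
    ∣s∣*d≡∣r-r′∣ = trans (sym (ℤ.abs-* s (+ d))) (cong ℤ.∣_∣ (sym eq))
    ∣r-r′∣<d : ℤ.∣ + r - + r′ ∣ ℕ.< d
    ∣r-r′∣<d = ℕ.≤-<-trans
      (subst (ℕ._≤ r ℕ.⊔ r′) (cong ℤ.∣_∣ (sym (ℤ.[+m]-[+n]≡m⊖n r r′))) (ℤ.∣m⊝n∣≤m⊔n r r′))
      (ℕ.⊔-lub r<d r′<d)
    s≡0 : s ≡ + 0
    s≡0 = ℤ.∣i∣≡0⇒i≡0 (ℕ.n<1⇒n≡0 (ℕ.*-cancelʳ-< d _ 1
            (subst₂ ℕ._<_ (sym ∣s∣*d≡∣r-r′∣) (sym (ℕ.*-identityˡ d)) ∣r-r′∣<d)))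

  module _ (d : ℕ) .{{_ : ℕ.NonZero d}} where

    private
      x≡[x%d]+[x/d]*d : ∀ x → x ≡ + (x % + d) + (x / + d) * + d
      x≡[x%d]+[x/d]*d x = a≡a%n+[a/n]*n x (+ d)

    division-unique : ∀ {x r r′ q q′} → r ℕ.< d → r′ ℕ.< d →
                      x ≡ + r + q * + d → x ≡ + r′ + q′ * + d → r ≡ r′ × q ≡ q′
    division-unique {x} {r} {r′} {q} {q′} r<d r′<d x≡r+qd x≡r′+q′d = r≡r′ , q≡q′
      where
      r+qd≡r′+q′d : + r + q * + d ≡ + r′ + q′ * + d
      r+qd≡r′+q′d = trans (sym x≡r+qd) x≡r′+q′d
      shift : ∀ a b c D → a - c ≡ (a + b * D) - (c + b * D)
      shift = solve-∀
      collect : ∀ b c e D → (c + e * D) - (c + b * D) ≡ (e - b) * D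
      collect = solve-∀
      r-r′≡[q′-q]*d : + r - + r′ ≡ (q′ - q) * + d
      r-r′≡[q′-q]*d = trans (shift (+ r) q (+ r′) (+ d))
        (trans (cong (_- (+ r′ + q * + d)) r+qd≡r′+q′d) (collect q (+ r′) q′ (+ d)))
      r≡r′ : r ≡ r′
      r≡r′ = remainder-unique r<d r′<d (divides (q′ - q) r-r′≡[q′-q]*d)
      q≡q′ : q ≡ q′
      q≡q′ = sym (ℤ.i-j≡0⇒i≡j q′ q (ℤ.*-cancelʳ-≡ (q′ - q) (+ 0) (+ d)
        (trans (sym r-r′≡[q′-q]*d) (trans (cong (λ s → + r - + s) (sym r≡r′)) (ℤ.+-inverseʳ (+ r))))))

    [q*d]/d≡q : ∀ q → q * + d / + d ≡ q
    [q*d]/d≡q q = proj₂ (division-unique (n%d<d (q * + d) (+ d)) (ℕ.>-nonZero⁻¹ d)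
                    (x≡[x%d]+[x/d]*d (q * + d)) (sym (ℤ.+-identityˡ (q * + d))))

    %-≡⇔∣- : ∀ x y → x % + d ≡ y % + d ⇔ + d ∣ x - y
    %-≡⇔∣- x y = ⇔-trans (mk⇔ ∣rx-ry (remainder-unique (n%d<d x (+ d)) (n%d<d y (+ d)))) (⇔-sym ∣x-y⇔∣rx-ry)
      where
      ∣rx-ry : x % + d ≡ y % + d → + d ∣ + (x % + d) - + (y % + d)
      ∣rx-ry rx≡ry = subst (λ r → + d ∣ + (x % + d) - + r) rx≡ry (divides (+ 0) (ℤ.+-inverseʳ (+ (x % + d))))

      difference : ∀ rx ry qx qy D → (rx + qx * D) - (ry + qy * D) - (rx - ry) ≡ (qx - qy) * D
      difference = solve-∀

      ∣x-y⇔∣rx-ry : + d ∣ x - y ⇔ + d ∣ + (x % + d) - + (y % + d)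
      ∣x-y⇔∣rx-ry = ∣x-y⇒∣x⇔∣y (divides (x / + d - y / + d)
        (trans (cong₂ (λ x′ y′ → x′ - y′ - (+ (x % + d) - + (y % + d))) (x≡[x%d]+[x/d]*d x) (x≡[x%d]+[x/d]*d y))
               (difference (+ (x % + d)) (+ (y % + d)) (x / + d) (y / + d) (+ d))))

  ∣x⇒∣x+y⇔∣y : ∀ {d x y} → d ∣ x → d ∣ x + y ⇔ d ∣ y
  ∣x⇒∣x+y⇔∣y {d} {x} {y} d∣x = ∣x-y⇒∣x⇔∣y (subst (d ∣_) (x≡x+y-y x y) d∣x)
    where
    x≡x+y-y : ∀ x y → x ≡ x + y - y
    x≡x+y-y = solve-∀
  %2≡0⇔2∣ : ∀ x → mod2 x ≡ 0 ⇔ + 2 ∣ x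
  %2≡0⇔2∣ x = subst (λ y → mod2 x ≡ 0 ⇔ + 2 ∣ y) (ℤ.+-identityʳ x) (%-≡⇔∣- 2 x (+ 0))

  square≡wtE₄[mod8] : ∀ x → + 8 ∣ + wtE₄ x - x * x
  square≡wtE₄[mod8] x with x / + 4 | x % + 4 | n%d<d x (+ 4) | a≡a%n+[a/n]*n x (+ 4)
  ... | q | 0 | _ | x≡ = divides (- (+ 2 * q * q)) (trans (cong (λ x → + 0 - x * x) x≡) (r0 q))
    where
    r0 : ∀ q → + 0 - (+ 0 + q * + 4) * (+ 0 + q * + 4) ≡ (- (+ 2 * q * q)) * + 8
    r0 = solve-∀
  ... | q | 1 | _ | x≡ = divides (- q - + 2 * q * q) (trans (cong (λ x → + 1 - x * x) x≡) (r1 q))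
    where
    r1 : ∀ q → + 1 - (+ 1 + q * + 4) * (+ 1 + q * + 4) ≡ (- q - + 2 * q * q) * + 8
    r1 = solve-∀
  ... | q | 2 | _ | x≡ = divides (- (+ 2 * q) - + 2 * q * q) (trans (cong (λ x → + 4 - x * x) x≡) (r2 q))
    where
    r2 : ∀ q → + 4 - (+ 2 + q * + 4) * (+ 2 + q * + 4) ≡ (- (+ 2 * q) - + 2 * q * q) * + 8
    r2 = solve-∀
  ... | q | 3 | _ | x≡ = divides (- + 1 - + 3 * q - + 2 * q * q) (trans (cong (λ x → + 1 - x * x) x≡) (r3 q))
    where
    r3 : ∀ q → + 1 - (+ 3 + q * + 4) * (+ 3 + q * + 4) ≡ (- + 1 - + 3 * q - + 2 * q * q) * + 8
    r3 = solve-∀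
  ... | _ | suc (suc (suc (suc _))) | s≤s (s≤s (s≤s (s≤s ()))) | _

  square≡parity[mod4] : ∀ x → + 4 ∣ + (if does (mod2 x ℕ.≟ 0) then 0 else 1) - x * x
  square≡parity[mod4] x with x / + 2 | x % + 2 | n%d<d x (+ 2) | a≡a%n+[a/n]*n x (+ 2)
  ... | q | 0 | _ | x≡ = divides (- (q * q)) (trans (cong (λ x → + 0 - x * x) x≡) (r0 q))
    where
    r0 : ∀ q → + 0 - (+ 0 + q * + 2) * (+ 0 + q * + 2) ≡ (- (q * q)) * + 4
    r0 = solve-∀
  ... | q | 1 | _ | x≡ = divides (- q - q * q) (trans (cong (λ x → + 1 - x * x) x≡) (r1 q))
    where
    r1 : ∀ q → + 1 - (+ 1 + q * + 2) * (+ 1 + q * + 2) ≡ (- q - q * q) * + 4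
    r1 = solve-∀
  ... | _ | suc (suc _) | s≤s (s≤s ()) | _

  square≡self[mod2] : ∀ x → + 2 ∣ x * x - x
  square≡self[mod2] x with x / + 2 | x % + 2 | n%d<d x (+ 2) | a≡a%n+[a/n]*n x (+ 2)
  ... | q | 0 | _ | x≡ = divides (+ 2 * q * q - q) (trans (cong (λ x → x * x - x) x≡) (r0 q))
    where
    r0 : ∀ q → (+ 0 + q * + 2) * (+ 0 + q * + 2) - (+ 0 + q * + 2) ≡ (+ 2 * q * q - q) * + 2
    r0 = solve-∀
  ... | q | 1 | _ | x≡ = divides (+ 2 * q * q + q) (trans (cong (λ x → x * x - x) x≡) (r1 q))
    where
    r1 : ∀ q → (+ 1 + q * + 2) * (+ 1 + q * + 2) - (+ 1 + q * + 2) ≡ (+ 2 * q * q + q) * + 2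
    r1 = solve-∀
  ... | _ | suc (suc _) | s≤s (s≤s ()) | _

  -- Finite sums and the dot product

  Σℤ-cong : ∀ {n} {f g : Fin n → ℤ} → (∀ j → f j ≡ g j) → Σℤ f ≡ Σℤ g
  Σℤ-cong {zero}  f≗g = refl
  Σℤ-cong {suc n} f≗g = cong₂ _+_ (f≗g zero) (Σℤ-cong (f≗g ∘ suc))

  Σℤ-zero : ∀ n → Σℤ {n} (λ _ → + 0) ≡ + 0
  Σℤ-zero zero    = refl
  Σℤ-zero (suc n) = cong (_+_ (+ 0)) (Σℤ-zero n)

  Σℤ-one : ∀ n → Σℤ {n} (λ _ → + 1) ≡ + n
  Σℤ-one zero    = refl
  Σℤ-one (suc n) = cong (_+_ (+ 1)) (Σℤ-one n)

  Σℤ-distrib-+ : ∀ {n} (f g : Fin n → ℤ) → Σℤ (λ j → f j + g j) ≡ Σℤ f + Σℤ g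
  Σℤ-distrib-+ {zero}  f g = refl
  Σℤ-distrib-+ {suc n} f g =
    trans (cong (_+_ (f zero + g zero)) (Σℤ-distrib-+ (f ∘ suc) (g ∘ suc))) (interchange (f zero) (g zero) _ _)
    where
    interchange : ∀ a b c d → a + b + (c + d) ≡ a + c + (b + d)
    interchange = solve-∀

  *-distribˡ-Σℤ : ∀ {n} a (f : Fin n → ℤ) → a * Σℤ f ≡ Σℤ (λ j → a * f j)
  *-distribˡ-Σℤ {zero}  a f = ℤ.*-zeroʳ a
  *-distribˡ-Σℤ {suc n} a f =
    trans (ℤ.*-distribˡ-+ a (f zero) _) (cong (_+_ (a * f zero)) (*-distribˡ-Σℤ a (f ∘ suc)))

  ∣Σℤ-Σℤ : ∀ {n d} {f g : Fin n → ℤ} → (∀ j → d ∣ f j - g j) → d ∣ Σℤ f - Σℤ g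
  ∣Σℤ-Σℤ {zero}          _      = divides (+ 0) refl
  ∣Σℤ-Σℤ {suc n} {f = f} {g} d∣f-g = subst (_ ∣_) (regroup (f zero) (g zero) _ _)
    (∣m∣n⇒∣m+n (d∣f-g zero) (∣Σℤ-Σℤ (d∣f-g ∘ suc)))
    where
    regroup : ∀ a b c e → a - b + (c - e) ≡ (a + c) - (b + e)
    regroup = solve-∀

  pos-Σℕ : ∀ {n} (f : Fin n → ℕ) → + Σℕ f ≡ Σℤ (λ j → + f j)
  pos-Σℕ {zero}  f = refl
  pos-Σℕ {suc n} f = cong (_+_ (+ f zero)) (pos-Σℕ (f ∘ suc))

  Σℤ-↑ : ∀ a b (f : Fin (a ℕ.+ b) → ℤ) → Σℤ f ≡ Σℤ (λ i → f (i ↑ˡ b)) + Σℤ (λ i → f (a ↑ʳ i))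
  Σℤ-↑ zero    b f = sym (ℤ.+-identityˡ _)
  Σℤ-↑ (suc a) b f = trans (cong (_+_ (f zero)) (Σℤ-↑ a b (f ∘ suc))) (sym (ℤ.+-assoc (f zero) _ _))

  I-diagonal : ∀ {n} (i : Fin n) → I i i ≡ + 1
  I-diagonal i rewrite dec-true (i ≟ i) refl = refl

  I-offDiagonal : ∀ {n} {i j : Fin n} → i ≢ j → I i j ≡ + 0
  I-offDiagonal {i = i} {j} i≢j rewrite dec-false (i ≟ j) i≢j = refl

  Diag-diagonal : ∀ {n} (S : Mat n n) i → Diag S i i ≡ S i i
  Diag-diagonal S i rewrite dec-true (i ≟ i) refl = refl

  Diag-offDiagonal : ∀ {n} (S : Mat n n) {i j} → i ≢ j → Diag S i j ≡ + 0
  Diag-offDiagonal S {i} {j} i≢j rewrite dec-false (i ≟ j) i≢j = refl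

  Σℤ-δ : ∀ {n} (i : Fin n) (f : Fin n → ℤ) → Σℤ (λ l → I i l * f l) ≡ f i
  Σℤ-δ {suc n} zero    f = trans (cong₂ _+_ (ℤ.*-identityˡ (f zero)) (Σℤ-zero n)) (ℤ.+-identityʳ (f zero))
  Σℤ-δ {suc n} (suc i) f = trans (ℤ.+-identityˡ _) (Σℤ-δ i (f ∘ suc))

  infix 7 _∙_
  _∙_ : ∀ {c} → Vect c → Vect c → ℤ
  u ∙ v = Σℤ (λ j → u j * v j)

  ∙-comm : ∀ {c} (u v : Vect c) → u ∙ v ≡ v ∙ u
  ∙-comm u v = Σℤ-cong (λ j → ℤ.*-comm (u j) (v j))

  ∙-zeroʳ : ∀ {c} (u : Vect c) → u ∙ (λ _ → + 0) ≡ + 0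
  ∙-zeroʳ {c} u = trans (Σℤ-cong (λ j → ℤ.*-zeroʳ (u j))) (Σℤ-zero c)

  ∙-cong : ∀ {c} {u u′ v v′ : Vect c} → (∀ j → u j ≡ u′ j) → (∀ j → v j ≡ v′ j) → u ∙ v ≡ u′ ∙ v′
  ∙-cong u≗u′ v≗v′ = Σℤ-cong (λ j → cong₂ _*_ (u≗u′ j) (v≗v′ j))

  ∙-distribˡ-+ : ∀ {c} (u v w : Vect c) → u ∙ (λ j → v j + w j) ≡ u ∙ v + u ∙ w
  ∙-distribˡ-+ u v w =
    trans (Σℤ-cong (λ j → ℤ.*-distribˡ-+ (u j) (v j) (w j))) (Σℤ-distrib-+ (λ j → u j * v j) (λ j → u j * w j))

  ∙-distribʳ-+ : ∀ {c} (u v w : Vect c) → (λ j → u j + v j) ∙ w ≡ u ∙ w + v ∙ w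
  ∙-distribʳ-+ u v w =
    trans (Σℤ-cong (λ j → ℤ.*-distribʳ-+ (w j) (u j) (v j))) (Σℤ-distrib-+ (λ j → u j * w j) (λ j → v j * w j))

  ∙-*ˡ : ∀ {c} s (u v : Vect c) → (λ j → s * u j) ∙ v ≡ s * (u ∙ v)
  ∙-*ˡ s u v = trans (Σℤ-cong (λ j → ℤ.*-assoc s (u j) (v j))) (sym (*-distribˡ-Σℤ s (λ j → u j * v j)))

  ∙-*ʳ : ∀ {c} s (u v : Vect c) → u ∙ (λ j → s * v j) ≡ s * (u ∙ v)
  ∙-*ʳ s u v = trans (∙-comm u _) (trans (∙-*ˡ s v u) (cong (s *_) (∙-comm v u)))

  ∙-+-+ : ∀ {c} (u v u′ v′ : Vect c) →
          (λ j → u j + v j) ∙ (λ j → u′ j + v′ j) ≡ u ∙ u′ + u ∙ v′ + (v ∙ u′ + v ∙ v′)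
  ∙-+-+ u v u′ v′ = trans (∙-distribʳ-+ u v _) (cong₂ _+_ (∙-distribˡ-+ u u′ v′) (∙-distribˡ-+ v u′ v′))

  ∙-square-+ : ∀ {c} (u v : Vect c) →
               (λ j → u j + v j) ∙ (λ j → u j + v j) ≡ u ∙ u + + 2 * (u ∙ v) + v ∙ v
  ∙-square-+ u v = trans (∙-+-+ u v u v) (trans (cong (λ x → u ∙ u + u ∙ v + (x + v ∙ v)) (∙-comm v u))
                     (expand (u ∙ u) (u ∙ v) (v ∙ v)))
    where
    expand : ∀ a b e → a + b + (b + e) ≡ a + + 2 * b + e
    expand = solve-∀

  ∙-+2* : ∀ {c} (u v u′ v′ : Vect c) →
          (λ j → u j + + 2 * v j) ∙ (λ j → u′ j + + 2 * v′ j)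
            ≡ u ∙ u′ + + 2 * (u ∙ v′ + v ∙ u′) + + 4 * (v ∙ v′)
  ∙-+2* u v u′ v′ = begin
    (λ j → u j + + 2 * v j) ∙ (λ j → u′ j + + 2 * v′ j)
      ≡⟨ ∙-+-+ u (λ j → + 2 * v j) u′ (λ j → + 2 * v′ j) ⟩
    u ∙ u′ + u ∙ 2v′ + (2v ∙ u′ + 2v ∙ 2v′)
      ≡⟨ cong₂ (λ x y → u ∙ u′ + x + y) (∙-*ʳ (+ 2) u v′)
               (cong₂ _+_ (∙-*ˡ (+ 2) v u′) (trans (∙-*ˡ (+ 2) v 2v′) (cong (+ 2 *_) (∙-*ʳ (+ 2) v v′)))) ⟩
    u ∙ u′ + + 2 * (u ∙ v′) + (+ 2 * (v ∙ u′) + + 2 * (+ 2 * (v ∙ v′)))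
      ≡⟨ collect (u ∙ u′) (u ∙ v′) (v ∙ u′) (v ∙ v′) ⟩
    u ∙ u′ + + 2 * (u ∙ v′ + v ∙ u′) + + 4 * (v ∙ v′) ∎
    where
    open ≡-Reasoning
    2v 2v′ : Vect _
    2v j = + 2 * v j
    2v′ j = + 2 * v′ j
    collect : ∀ a b e f → a + + 2 * b + (+ 2 * e + + 2 * (+ 2 * f)) ≡ a + + 2 * (b + e) + + 4 * f
    collect = solve-∀

  Σℤ-+2* : ∀ {c} (u v : Vect c) → Σℤ (λ j → u j + + 2 * v j) ≡ Σℤ u + + 2 * Σℤ v
  Σℤ-+2* u v = trans (Σℤ-distrib-+ u _) (cong (_+_ (Σℤ u)) (sym (*-distribˡ-Σℤ (+ 2) v)))

  binary⇒Σℤ≡∙ : ∀ {c} (v : Vect c) → (∀ j → v j ≡ + 0 ⊎ v j ≡ + 1) → Σℤ v ≡ v ∙ v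
  binary⇒Σℤ≡∙ v v∈01 = Σℤ-cong idempotent
    where
    idempotent : ∀ j → v j ≡ v j * v j
    idempotent j with v∈01 j
    ... | inj₁ vj≡0 rewrite vj≡0 = refl
    ... | inj₂ vj≡1 rewrite vj≡1 = refl

  -- Weights of codewords as values of a quadratic form

  wtE≡∙[mod8] : ∀ {c} (v : Vect c) → + 8 ∣ + wtE v - v ∙ v
  wtE≡∙[mod8] v = subst (λ w → + 8 ∣ w - v ∙ v) (sym (pos-Σℕ (λ j → wtE₄ (v j))))
    (∣Σℤ-Σℤ {f = λ j → + wtE₄ (v j)} {g = λ j → v j * v j} (λ j → square≡wtE₄[mod8] (v j)))

  wtH₂≡∙[mod4] : ∀ {c} (v : Vect c) → + 4 ∣ + wtH₂ v - v ∙ v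
  wtH₂≡∙[mod4] v = subst (λ w → + 4 ∣ w - v ∙ v) (sym (pos-Σℕ parity))
    (∣Σℤ-Σℤ {f = λ j → + parity j} {g = λ j → v j * v j} (λ j → square≡parity[mod4] (v j)))
    where
    parity : Fin _ → ℕ
    parity j = if does (mod2 (v j) ℕ.≟ 0) then 0 else 1

  codeword-δ : ∀ {r c} (G : Mat r c) i t → codeword (I i) G t ≡ G i t
  codeword-δ G i t = Σℤ-δ i (λ s → G s t)

  codeword-δ+δ : ∀ {r c} (G : Mat r c) i j t → codeword (λ s → I i s + I j s) G t ≡ G i t + G j t
  codeword-δ+δ G i j t = trans (Σℤ-cong (λ s → ℤ.*-distribʳ-+ (G s t) (I i s) (I j s)))
    (trans (Σℤ-distrib-+ (λ s → I i s * G s t) (λ s → I j s * G s t))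
           (cong₂ _+_ (codeword-δ G i t) (codeword-δ G j t)))

  ∣∙codeword : ∀ {r c d} (u : Vect c) (G : Mat r c) → (∀ i → d ∣ u ∙ G i) → ∀ a → d ∣ u ∙ codeword a G
  ∣∙codeword {zero}  u G _     a = subst (_ ∣_) (sym (∙-zeroʳ u)) (divides (+ 0) refl)
  ∣∙codeword {suc r} u G d∣uGᵢ a =
    subst (_ ∣_) (sym (trans (∙-distribˡ-+ u _ _)
                             (cong (_+ u ∙ codeword (a ∘ suc) (G ∘ suc)) (∙-*ʳ (a zero) u (G zero)))))
      (∣m∣n⇒∣m+n (∣n⇒∣m*n (a zero) (d∣uGᵢ zero)) (∣∙codeword u (G ∘ suc) (d∣uGᵢ ∘ suc) (a ∘ suc)))

  squares-∣⇔gram-∣ : ∀ {r c} d (G : Mat r c) →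
    (∀ a → + 2 * d ∣ codeword a G ∙ codeword a G) ⇔ ((∀ i → + 2 * d ∣ G i ∙ G i) × (∀ i j → d ∣ G i ∙ G j))
  squares-∣⇔gram-∣ {c = c} d G =
    mk⇔ (λ squares → diagonal squares , entries squares) (λ (Qᵢ , Bᵢⱼ) → squares Qᵢ Bᵢⱼ)
    where
    diagonal : (∀ a → + 2 * d ∣ codeword a G ∙ codeword a G) → ∀ i → + 2 * d ∣ G i ∙ G i
    diagonal squares i = subst (_ ∣_) (∙-cong (codeword-δ G i) (codeword-δ G i)) (squares (I i))

    entries : (∀ a → + 2 * d ∣ codeword a G ∙ codeword a G) → ∀ i j → d ∣ G i ∙ G j
    entries squares i j = *-cancelˡ-∣ (+ 2) (subst (_ ∣_) (cancel (G i ∙ G i) (G i ∙ G j) (G j ∙ G j))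
        (∣m∣n⇒∣m-n Qᵢ₊ⱼ (∣m∣n⇒∣m+n (diagonal squares i) (diagonal squares j))))
      where
      Qᵢ₊ⱼ : + 2 * d ∣ G i ∙ G i + + 2 * (G i ∙ G j) + G j ∙ G j
      Qᵢ₊ⱼ = subst (_ ∣_) (trans (∙-cong (codeword-δ+δ G i j) (codeword-δ+δ G i j)) (∙-square-+ (G i) (G j)))
               (squares (λ s → I i s + I j s))
      cancel : ∀ a b e → a + + 2 * b + e - (a + e) ≡ + 2 * b
      cancel = solve-∀

    squares : ∀ {r} {G : Mat r c} → (∀ i → + 2 * d ∣ G i ∙ G i) → (∀ i j → d ∣ G i ∙ G j)
            → ∀ a → + 2 * d ∣ codeword a G ∙ codeword a G
    squares {zero}      Qᵢ Bᵢⱼ a = subst (_ ∣_) (sym (Σℤ-zero c)) (divides (+ 0) refl)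
    squares {suc r} {G} Qᵢ Bᵢⱼ a = subst (_ ∣_) (sym (begin
        (λ j → x j + y j) ∙ (λ j → x j + y j)
          ≡⟨ ∙-square-+ x y ⟩
        x ∙ x + + 2 * (x ∙ y) + y ∙ y
          ≡⟨ cong₂ (λ p q → p + + 2 * q + y ∙ y)
                   (trans (∙-*ˡ a₀ (G zero) x) (cong (a₀ *_) (∙-*ʳ a₀ (G zero) (G zero))))
                   (∙-*ˡ a₀ (G zero) y) ⟩
        a₀ * (a₀ * (G zero ∙ G zero)) + + 2 * (a₀ * (G zero ∙ y)) + y ∙ y ∎))
      (∣m∣n⇒∣m+n (∣m∣n⇒∣m+n (∣n⇒∣m*n a₀ (∣n⇒∣m*n a₀ (Qᵢ zero)))
                              (*-monoʳ-∣ (+ 2) (∣n⇒∣m*n a₀ d∣G₀∙y)))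
                 (squares (Qᵢ ∘ suc) (λ i j → Bᵢⱼ (suc i) (suc j)) (a ∘ suc)))
      where
      open ≡-Reasoning
      a₀ : ℤ
      a₀ = a zero
      x y : Vect c
      x j = a₀ * G zero j
      y = codeword (a ∘ suc) (G ∘ suc)
      d∣G₀∙y : d ∣ G zero ∙ y
      d∣G₀∙y = ∣∙codeword (G zero) (G ∘ suc) (Bᵢⱼ zero ∘ suc) (a ∘ suc)

  EvenGram : ∀ {r c} → Mat r c → Set
  EvenGram {r} G = (∀ i → + 8 ∣ G i ∙ G i) × (∀ (i j : Fin r) → + 4 ∣ G i ∙ G j)

  evenQuaternary⇔evenGram : ∀ {r c} (G : Mat r c) → EvenQuaternary G ⇔ EvenGram G
  evenQuaternary⇔evenGram G = mk⇔
    (λ even → Equivalence.to (squares-∣⇔gram-∣ (+ 4) G) (λ a → Equivalence.to (8∣wtE⇔8∣∙ a) (even a)))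
    (λ gram a → Equivalence.from (8∣wtE⇔8∣∙ a) (Equivalence.from (squares-∣⇔gram-∣ (+ 4) G) gram a))
    where
    8∣wtE⇔8∣∙ : ∀ a → 8 ∣ℕ wtE (codeword a G) ⇔ + 8 ∣ codeword a G ∙ codeword a G
    8∣wtE⇔8∣∙ a = ⇔-trans ∣ℕ⇔∣ (∣x-y⇒∣x⇔∣y (wtE≡∙[mod8] (codeword a G)))

  doublyEven⇒gram : ∀ {r c} (G : Mat r c) → DoublyEvenBinary G →
                    (∀ i → + 4 ∣ G i ∙ G i) × (∀ i j → + 2 ∣ G i ∙ G j)
  doublyEven⇒gram G doublyEven = Equivalence.to (squares-∣⇔gram-∣ (+ 2) G)
    (λ a → Equivalence.to (∣x-y⇒∣x⇔∣y {x = + wtH₂ (codeword a G)} (wtH₂≡∙[mod4] (codeword a G)))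
                          (∣ᵤ⇒∣ (doublyEven a)))

  EvenGramGivenRow₀ : ∀ {k c} → Mat (suc k) c → Set
  EvenGramGivenRow₀ G = (∀ i → + 4 ∣ G zero ∙ G (suc i)) × (∀ i → + 8 ∣ G (suc i) ∙ G (suc i))
                        × (∀ i j → i ≢ j → + 4 ∣ G (suc i) ∙ G (suc j))

  EvenGram-suc⇔ : ∀ {k c} (G : Mat (suc k) c) → + 8 ∣ G zero ∙ G zero → EvenGram G ⇔ EvenGramGivenRow₀ G
  EvenGram-suc⇔ G 8∣G₀∙G₀ = mk⇔
    (λ (diagonal , entries) → (λ i → entries zero (suc i)) , diagonal ∘ suc , λ i j _ → entries (suc i) (suc j))
    (λ (row₀ , diagonal , offDiagonal) → diagonal′ diagonal , entries row₀ diagonal offDiagonal)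
    where
    8∣⇒4∣ : ∀ {x} → + 8 ∣ x → + 4 ∣ x
    8∣⇒4∣ = ∣-trans (divides (+ 2) refl)

    diagonal′ : (∀ i → + 8 ∣ G (suc i) ∙ G (suc i)) → ∀ i → + 8 ∣ G i ∙ G i
    diagonal′ _        zero    = 8∣G₀∙G₀
    diagonal′ diagonal (suc i) = diagonal i

    entries : (∀ i → + 4 ∣ G zero ∙ G (suc i)) → (∀ i → + 8 ∣ G (suc i) ∙ G (suc i))
            → (∀ i j → i ≢ j → + 4 ∣ G (suc i) ∙ G (suc j)) → ∀ i j → + 4 ∣ G i ∙ G j
    entries _    _        _           zero    zero    = 8∣⇒4∣ 8∣G₀∙G₀
    entries row₀ _        _           zero    (suc j) = row₀ j
    entries row₀ _        _           (suc i) zero    = subst (_ ∣_) (∙-comm (G zero) (G (suc i))) (row₀ i)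
    entries _    diagonal offDiagonal (suc i) (suc j) with i ≟ j
    ... | yes refl = 8∣⇒4∣ (diagonal i)
    ... | no i≢j   = offDiagonal i j i≢j

  ∀²⇔diagonal×offDiagonal : ∀ {n} {P : Fin n → Fin n → Set} →
    (∀ i j → P i j) ⇔ ((∀ i → P i i) × (∀ i j → i ≢ j → P i j))
  ∀²⇔diagonal×offDiagonal {P = P} = mk⇔ (λ p → (λ i → p i i) , λ i j _ → p i j) (λ (d , o) → all d o)
    where
    all : (∀ i → P i i) → (∀ i j → i ≢ j → P i j) → ∀ i j → P i j
    all diagonal offDiagonal i j with i ≟ j
    ... | yes refl = diagonal i
    ... | no i≢j   = offDiagonal i j i≢j

  -- The generator matrix [1 𝟏 𝟏; 0 I M]

  module _ {k m} (M : Mat k m) where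

    private
      row-I : ∀ i l → genMat M (suc i) (suc l ↑ˡ m) ≡ I i l
      row-I i l rewrite splitAt-↑ˡ k l m = refl

      row-M : ∀ i l → genMat M (suc i) (suc k ↑ʳ l) ≡ M i l
      row-M i l rewrite splitAt-↑ʳ k m l = refl

    ∣length⇒∣row₀∙row₀ : ∀ {d} → d ∣ℕ suc k ℕ.+ m → + d ∣ genMat M zero ∙ genMat M zero
    ∣length⇒∣row₀∙row₀ d∣n = subst (_ ∣_) (sym (Σℤ-one (suc k ℕ.+ m))) (∣ᵤ⇒∣ d∣n)

    genMat-row₀∙row : ∀ i → genMat M zero ∙ genMat M (suc i) ≡ + 1 + Σℤ (M i)
    genMat-row₀∙row i = begin
      genMat M zero ∙ genMat M (suc i)
        ≡⟨ Σℤ-↑ (suc k) m (λ t → + 1 * genMat M (suc i) t) ⟩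
      (+ 0 + Σℤ (λ l → + 1 * genMat M (suc i) (suc l ↑ˡ m))) + Σℤ (λ l → + 1 * genMat M (suc i) (suc k ↑ʳ l))
        ≡⟨ cong₂ (λ x y → + 0 + x + y)
             (trans (Σℤ-cong (λ l → trans (ℤ.*-identityˡ _) (trans (row-I i l) (sym (ℤ.*-identityʳ (I i l))))))
                    (Σℤ-δ i (λ _ → + 1)))
             (Σℤ-cong (λ l → trans (ℤ.*-identityˡ _) (row-M i l))) ⟩
      + 0 + + 1 + Σℤ (M i) ∎
      where open ≡-Reasoning

    genMat-row∙row : ∀ i j → genMat M (suc i) ∙ genMat M (suc j) ≡ I i j + M i ∙ M j
    genMat-row∙row i j = begin
      genMat M (suc i) ∙ genMat M (suc j)
        ≡⟨ Σℤ-↑ (suc k) m (λ t → genMat M (suc i) t * genMat M (suc j) t) ⟩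
      (+ 0 + Σℤ (λ l → genMat M (suc i) (suc l ↑ˡ m) * genMat M (suc j) (suc l ↑ˡ m)))
        + Σℤ (λ l → genMat M (suc i) (suc k ↑ʳ l) * genMat M (suc j) (suc k ↑ʳ l))
        ≡⟨ cong₂ (λ x y → + 0 + x + y)
             (trans (Σℤ-cong (λ l → trans (cong₂ _*_ (row-I i l) (row-I j l)) (ℤ.*-comm (I i l) (I j l))))
                    (Σℤ-δ j (I i)))
             (Σℤ-cong (λ l → cong₂ _*_ (row-M i l) (row-M j l))) ⟩
      + 0 + I i j + M i ∙ M j
        ≡⟨ cong (_+ M i ∙ M j) (ℤ.+-identityˡ (I i j)) ⟩
      I i j + M i ∙ M j ∎
      where open ≡-Reasoning

  -- The quaternary lift of a doubly even binary code

  Φ-diagonal : ∀ {k m} (A N : Mat k m) i → Φ A N i i ≡ A i ∙ N i + A i ∙ N i + A i ∙ N i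
  Φ-diagonal A N i = cong₂ (λ v d → A i ∙ N i + v + d) (∙-comm (N i) (A i)) (Diag-diagonal (A · (N ᵗ)) i)

  Φ-offDiagonal : ∀ {k m} (A N : Mat k m) {i j} → i ≢ j → Φ A N i j ≡ A i ∙ N j + N i ∙ A j
  Φ-offDiagonal A N {i} {j} i≢j =
    trans (cong (_+_ (A i ∙ N j + N i ∙ A j)) (Diag-offDiagonal (A · (N ᵗ)) i≢j)) (ℤ.+-identityʳ _)

  Target-diagonal : ∀ {k m} (A : Mat k m) i {c} → + 1 + A i ∙ A i ≡ c * + 4 → Target A i i ≡ c * + 2 + c
  Target-diagonal A i {c} 1+AᵢAᵢ≡4c = begin
    (I i i + A i ∙ A i) / + 2 + (I i i + Diag (A · (A ᵗ)) i i) / + 4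
      ≡⟨ cong₂ (λ δ a → (δ + A i ∙ A i) / + 2 + (δ + a) / + 4)
               (I-diagonal i) (Diag-diagonal (A · (A ᵗ)) i) ⟩
    (+ 1 + A i ∙ A i) / + 2 + (+ 1 + A i ∙ A i) / + 4
      ≡⟨ cong (λ x → x / + 2 + x / + 4) 1+AᵢAᵢ≡4c ⟩
    c * + 4 / + 2 + c * + 4 / + 4
      ≡⟨ cong₂ _+_ (trans (cong (_/ + 2) (sym (ℤ.*-assoc c (+ 2) (+ 2)))) ([q*d]/d≡q 2 (c * + 2)))
                   ([q*d]/d≡q 4 c) ⟩
    c * + 2 + c ∎
    where open ≡-Reasoning

  Target-offDiagonal : ∀ {k m} (A : Mat k m) {i j p} → i ≢ j → A i ∙ A j ≡ p * + 2 → Target A i j ≡ p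
  Target-offDiagonal A {i} {j} {p} i≢j AᵢAⱼ≡2p = begin
    (I i j + A i ∙ A j) / + 2 + (I i j + Diag (A · (A ᵗ)) i j) / + 4
      ≡⟨ cong₂ (λ δ a → (δ + A i ∙ A j) / + 2 + (δ + a) / + 4)
               (I-offDiagonal i≢j) (Diag-offDiagonal (A · (A ᵗ)) i≢j) ⟩
    (+ 0 + A i ∙ A j) / + 2 + + 0
      ≡⟨ cong (λ x → x / + 2 + + 0) (trans (ℤ.+-identityˡ _) AᵢAⱼ≡2p) ⟩
    p * + 2 / + 2 + + 0
      ≡⟨ trans (ℤ.+-identityʳ _) ([q*d]/d≡q 2 p) ⟩
    p ∎
    where open ≡-Reasoning

  module Lift {k m} (A : Mat k m) (A∈01 : ∀ i j → A i j ≡ + 0 ⊎ A i j ≡ + 1)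
           (doublyEven : DoublyEvenBinary (genMat A)) (N : Mat k m) where

    G : Mat (suc k) (suc k ℕ.+ m)
    G = genMat (A ⊕ ((+ 2) ⊙ N))

    private
      1+AᵢAᵢ≡0[mod4] : ∀ i → + 4 ∣ + 1 + A i ∙ A i
      1+AᵢAᵢ≡0[mod4] i = subst (+ 4 ∣_) (trans (genMat-row∙row A i i) (cong (_+ A i ∙ A i) (I-diagonal i)))
        (proj₁ (doublyEven⇒gram (genMat A) doublyEven) (suc i))

      AᵢAⱼ≡0[mod2] : ∀ {i j} → i ≢ j → + 2 ∣ A i ∙ A j
      AᵢAⱼ≡0[mod2] {i} {j} i≢j =
        subst (+ 2 ∣_)
          (trans (genMat-row∙row A i j) (trans (cong (_+ A i ∙ A j) (I-offDiagonal i≢j)) (ℤ.+-identityˡ _)))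
          (proj₂ (doublyEven⇒gram (genMat A) doublyEven) (suc i) (suc j))

      G₀∙Gᵢ : ∀ i → G zero ∙ G (suc i) ≡ + 1 + A i ∙ A i + + 2 * Σℤ (N i)
      G₀∙Gᵢ i = begin
        G zero ∙ G (suc i)
          ≡⟨ genMat-row₀∙row _ i ⟩
        + 1 + Σℤ (λ l → A i l + + 2 * N i l)
          ≡⟨ cong (_+_ (+ 1)) (Σℤ-+2* (A i) (N i)) ⟩
        + 1 + (Σℤ (A i) + + 2 * Σℤ (N i))
          ≡⟨ cong (λ x → + 1 + (x + + 2 * Σℤ (N i))) (binary⇒Σℤ≡∙ (A i) (A∈01 i)) ⟩
        + 1 + (A i ∙ A i + + 2 * Σℤ (N i))
          ≡⟨ ℤ.+-assoc (+ 1) (A i ∙ A i) _ ⟨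
        + 1 + A i ∙ A i + + 2 * Σℤ (N i) ∎
        where open ≡-Reasoning

      Gᵢ∙Gⱼ : ∀ i j → G (suc i) ∙ G (suc j)
                        ≡ I i j + (A i ∙ A j + + 2 * (A i ∙ N j + N i ∙ A j) + + 4 * (N i ∙ N j))
      Gᵢ∙Gⱼ i j = trans (genMat-row∙row _ i j) (cong (_+_ (I i j)) (∙-+2* (A i) (N i) (A j) (N j)))

      Gᵢ∙Gᵢ : ∀ i {c} → + 1 + A i ∙ A i ≡ c * + 4 →
              G (suc i) ∙ G (suc i) ≡ + 4 * (c + A i ∙ N i + N i ∙ N i)
      Gᵢ∙Gᵢ i {c} 1+AᵢAᵢ≡4c = begin
        G (suc i) ∙ G (suc i)
          ≡⟨ Gᵢ∙Gⱼ i i ⟩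
        I i i + (A i ∙ A i + + 2 * (A i ∙ N i + N i ∙ A i) + + 4 * (N i ∙ N i))
          ≡⟨ cong₂ (λ δ v → δ + (A i ∙ A i + + 2 * (A i ∙ N i + v) + + 4 * (N i ∙ N i)))
                   (I-diagonal i) (∙-comm (N i) (A i)) ⟩
        + 1 + (A i ∙ A i + + 2 * (A i ∙ N i + A i ∙ N i) + + 4 * (N i ∙ N i))
          ≡⟨ regroup (+ 1) (A i ∙ A i) (A i ∙ N i) (N i ∙ N i) ⟩
        (+ 1 + A i ∙ A i) + + 4 * (A i ∙ N i + N i ∙ N i)
          ≡⟨ cong (_+ + 4 * (A i ∙ N i + N i ∙ N i)) 1+AᵢAᵢ≡4c ⟩
        c * + 4 + + 4 * (A i ∙ N i + N i ∙ N i)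
          ≡⟨ factor c (A i ∙ N i) (N i ∙ N i) ⟩
        + 4 * (c + A i ∙ N i + N i ∙ N i) ∎
        where
        open ≡-Reasoning
        regroup : ∀ a p u w → a + (p + + 2 * (u + u) + + 4 * w) ≡ (a + p) + + 4 * (u + w)
        regroup = solve-∀
        factor : ∀ c u w → c * + 4 + + 4 * (u + w) ≡ + 4 * (c + u + w)
        factor = solve-∀

      Gᵢ∙Gⱼ-offDiagonal : ∀ {i j p} → i ≢ j → A i ∙ A j ≡ p * + 2 →
                          G (suc i) ∙ G (suc j) ≡ + 2 * (p + (A i ∙ N j + N i ∙ A j) + + 2 * (N i ∙ N j))
      Gᵢ∙Gⱼ-offDiagonal {i} {j} {p} i≢j AᵢAⱼ≡2p = begin
        G (suc i) ∙ G (suc j)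
          ≡⟨ Gᵢ∙Gⱼ i j ⟩
        I i j + (A i ∙ A j + + 2 * (A i ∙ N j + N i ∙ A j) + + 4 * (N i ∙ N j))
          ≡⟨ cong₂ (λ δ a → δ + (a + + 2 * (A i ∙ N j + N i ∙ A j) + + 4 * (N i ∙ N j)))
                   (I-offDiagonal i≢j) AᵢAⱼ≡2p ⟩
        + 0 + (p * + 2 + + 2 * (A i ∙ N j + N i ∙ A j) + + 4 * (N i ∙ N j))
          ≡⟨ factor p (A i ∙ N j + N i ∙ A j) (N i ∙ N j) ⟩
        + 2 * (p + (A i ∙ N j + N i ∙ A j) + + 2 * (N i ∙ N j)) ∎
        where
        open ≡-Reasoning
        factor : ∀ p s w → + 0 + (p * + 2 + + 2 * s + + 4 * w) ≡ + 2 * (p + s + + 2 * w)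
        factor = solve-∀

    row₀∙row-∣⇔ : ∀ i → + 4 ∣ G zero ∙ G (suc i) ⇔ mod2 (𝟏· (N ᵗ) i) ≡ 0
    row₀∙row-∣⇔ i = begin
      + 4 ∣ G zero ∙ G (suc i)                  ≡⟨ cong (+ 4 ∣_) (G₀∙Gᵢ i) ⟩
      + 4 ∣ + 1 + A i ∙ A i + + 2 * Σℤ (N i)    ≈⟨ ∣x⇒∣x+y⇔∣y (1+AᵢAᵢ≡0[mod4] i) ⟩
      + 4 ∣ + 2 * Σℤ (N i)                      ≈⟨ *-cancelˡ-∣⇔ (+ 2) ⟩
      + 2 ∣ Σℤ (N i)                            ≈⟨ ⇔-sym (%2≡0⇔2∣ (Σℤ (N i))) ⟩
      mod2 (𝟏· (N ᵗ) i) ≡ 0                     ∎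
      where open ⇔-Reasoning

    row∙row-diagonal-∣⇔ : ∀ i → mod2 (𝟏· (N ᵗ) i) ≡ 0 →
                          + 8 ∣ G (suc i) ∙ G (suc i) ⇔ mod2 (Φ A N i i) ≡ mod2 (Target A i i)
    row∙row-diagonal-∣⇔ i ker = diagonal-∣⇔ (1+AᵢAᵢ≡0[mod4] i)
      where
      open ⇔-Reasoning
      u w : ℤ
      u = A i ∙ N i
      w = N i ∙ N i

      2∣w : + 2 ∣ w
      2∣w = Equivalence.from (∣x-y⇒∣x⇔∣y (∣Σℤ-Σℤ (λ l → square≡self[mod2] (N i l))))
                             (Equivalence.to (%2≡0⇔2∣ (Σℤ (N i))) ker)

      difference : ∀ c u w → c + u + w - ((u + u + u) - (c * + 2 + c)) ≡ (c * + 2 - u) * + 2 + w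
      difference = solve-∀

      diagonal-∣⇔ : + 4 ∣ + 1 + A i ∙ A i →
                    + 8 ∣ G (suc i) ∙ G (suc i) ⇔ mod2 (Φ A N i i) ≡ mod2 (Target A i i)
      diagonal-∣⇔ (divides c 1+AᵢAᵢ≡4c) = begin
        + 8 ∣ G (suc i) ∙ G (suc i)
          ≡⟨ cong (+ 8 ∣_) (Gᵢ∙Gᵢ i {c} 1+AᵢAᵢ≡4c) ⟩
        + 8 ∣ + 4 * (c + u + w)
          ≈⟨ *-cancelˡ-∣⇔ (+ 4) ⟩
        + 2 ∣ c + u + w
          ≈⟨ ∣x-y⇒∣x⇔∣y (subst (+ 2 ∣_) (sym (difference c u w))
                                (∣m∣n⇒∣m+n (divides (c * + 2 - u) refl) 2∣w)) ⟩
        + 2 ∣ (u + u + u) - (c * + 2 + c)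
          ≡⟨ cong (+ 2 ∣_)
                  (cong₂ _-_ (Φ-diagonal A N i) (Target-diagonal A i {c} 1+AᵢAᵢ≡4c)) ⟨
        + 2 ∣ Φ A N i i - Target A i i
          ≈⟨ ⇔-sym (%-≡⇔∣- 2 (Φ A N i i) (Target A i i)) ⟩
        mod2 (Φ A N i i) ≡ mod2 (Target A i i) ∎

    row∙row-offDiagonal-∣⇔ : ∀ {i j} → i ≢ j →
                             + 4 ∣ G (suc i) ∙ G (suc j) ⇔ mod2 (Φ A N i j) ≡ mod2 (Target A i j)
    row∙row-offDiagonal-∣⇔ {i} {j} i≢j = offDiagonal-∣⇔ (AᵢAⱼ≡0[mod2] i≢j)
      where
      open ⇔-Reasoning
      u v w : ℤ
      u = A i ∙ N j
      v = N i ∙ A j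
      w = N i ∙ N j

      difference : ∀ p s w → p + s + + 2 * w - (s - p) ≡ (p + w) * + 2
      difference = solve-∀

      offDiagonal-∣⇔ : + 2 ∣ A i ∙ A j →
                       + 4 ∣ G (suc i) ∙ G (suc j) ⇔ mod2 (Φ A N i j) ≡ mod2 (Target A i j)
      offDiagonal-∣⇔ (divides p AᵢAⱼ≡2p) = begin
        + 4 ∣ G (suc i) ∙ G (suc j)
          ≡⟨ cong (+ 4 ∣_) (Gᵢ∙Gⱼ-offDiagonal {p = p} i≢j AᵢAⱼ≡2p) ⟩
        + 4 ∣ + 2 * (p + (u + v) + + 2 * w)
          ≈⟨ *-cancelˡ-∣⇔ (+ 2) ⟩
        + 2 ∣ p + (u + v) + + 2 * w
          ≈⟨ ∣x-y⇒∣x⇔∣y (divides (p + w) (difference p (u + v) w)) ⟩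
        + 2 ∣ (u + v) - p
          ≡⟨ cong (+ 2 ∣_)
                  (cong₂ _-_ (Φ-offDiagonal A N i≢j) (Target-offDiagonal A {p = p} i≢j AᵢAⱼ≡2p)) ⟨
        + 2 ∣ Φ A N i j - Target A i j
          ≈⟨ ⇔-sym (%-≡⇔∣- 2 (Φ A N i j) (Target A i j)) ⟩
        mod2 (Φ A N i j) ≡ mod2 (Target A i j) ∎

    Φ≡Target[mod2] : Fin k → Fin k → Set
    Φ≡Target[mod2] i j = mod2 (Φ A N i j) ≡ mod2 (Target A i j)

    evenGram⇔conditions : + 8 ∣ G zero ∙ G zero → EvenGram G ⇔ (InKerα N × (∀ i j → Φ≡Target[mod2] i j))
    evenGram⇔conditions 8∣G₀∙G₀ =
      ⇔-trans (EvenGram-suc⇔ G 8∣G₀∙G₀) (mk⇔ rows⇒conditions conditions⇒rows)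
      where
      open Equivalence

      rows⇒conditions : EvenGramGivenRow₀ G → InKerα N × (∀ i j → Φ≡Target[mod2] i j)
      rows⇒conditions (row₀ , diagonal , offDiagonal) = ker , from ∀²⇔diagonal×offDiagonal
        ( (λ i → to (row∙row-diagonal-∣⇔ i (ker i)) (diagonal i))
        , λ i j i≢j → to (row∙row-offDiagonal-∣⇔ i≢j) (offDiagonal i j i≢j))
        where
        ker : InKerα N
        ker i = to (row₀∙row-∣⇔ i) (row₀ i)

      conditions⇒rows : InKerα N × (∀ i j → Φ≡Target[mod2] i j) → EvenGramGivenRow₀ G
      conditions⇒rows (ker , entries) with to ∀²⇔diagonal×offDiagonal entries
      ... | diagonal , offDiagonal =
          (λ i → from (row₀∙row-∣⇔ i) (ker i))
        , (λ i → from (row∙row-diagonal-∣⇔ i (ker i)) (diagonal i))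
        , λ i j i≢j → from (row∙row-offDiagonal-∣⇔ i≢j) (offDiagonal i j i≢j)

open import Defs
open import Data.Nat using (ℕ; suc; _+_; _≤_; _/_)
open import Data.Nat.Divisibility using (_∣_)
open import Data.Integer using (+_)
open import Data.Sum using (_⊎_)
open import Data.Product using (_×_)
open import Relation.Binary.PropositionalEquality using (_≡_)
open import Function.Bundles using (_⇔_)
open import Function.Properties.Equivalence using () renaming (trans to ⇔-trans)
open Lemmas using (evenQuaternary⇔evenGram; module Lift; ∣length⇒∣row₀∙row₀)

lemma5p2 : (k m : ℕ) → 8 ∣ (suc k + m) → suc k ≤ (suc k + m) / 2
    → (A : Mat k m) → (∀ i j → A i j ≡ + 0 ⊎ A i j ≡ + 1)
    → DoublyEvenBinary (genMat A)
    → (N : Mat k m)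
    → EvenQuaternary (genMat (A ⊕ ((+ 2) ⊙ N)))
    ⇔ (InKerα N × (∀ i j → mod2 (Φ A N i j) ≡ mod2 (Target A i j)))
lemma5p2 k m 8∣n _ A A∈01 doublyEven N =
  ⇔-trans (evenQuaternary⇔evenGram G) (evenGram⇔conditions (∣length⇒∣row₀∙row₀ (A ⊕ ((+ 2) ⊙ N)) 8∣n))
  where open Lift A A∈01 doublyEven N
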